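{- Let $k > \ell \ge 1$ and $\lambda \ge 2$ be integers and let $\mathcal{H}$ be an $S^k_{\lambda}(\ell)$-free $k$-graph on vertex set $V$. Define $$\mathcal{H}_{k-1} = \left\{A \in \binom{V}{k-1} : d_{\mathcal{H}}(A) \ge k\lambda\right\}.$$ Further, suppose that for some integer $k'$ with $\ell < k' \le k-2$ and positive integers $\lambda'_1, \dots, \lambda'_{k-k'-1}$, the $k$-graph $\mathcal{H}$ is $\{S^k_{\lambda'_1}(k-1), \dots, S^k_{\lambda'_{k-k'-1}}(k'+1), S^k_{\lambda}(\ell)\}$-free, and define $$\mathcal{H}_{k'} = \left\{A \in \binom{V}{k'} : d_{\mathcal{H}}(A) \ge k\lambda \prod_{i=1}^{k-k'-1} (i+1)\lambda'_i\right\}.$$ Then the $(k-1)$-graph $\mathcal{H}_{k-1}$ is $S^{k-1}_{\lambda}(\ell)$-free and the $k'$-graph $\mathcal{H}_{k'}$ is $S^{k'}_{\lambda}(\ell)$-free.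
   Context: A $k$-graph is a family of $k$-element subsets (edges) of a finite vertex set. For $r > \ell \ge 1$ and $\lambda \ge 1$, $S^r_{\lambda}(\ell)$ is the $r$-graph consisting of $\lambda$ edges $E_1,\dots,E_\lambda$ with $E_i \cap E_j = S$ for all $i<j$, for a fixed $\ell$-set $S$; $S^k_{\lambda_i}(j)$ with $j=k-i$ means $S^k_{\lambda_i}(k-i)$. A hypergraph is $\mathcal{F}$-free (for a family $\mathcal{F}$) if it contains no member of $\mathcal{F}$ as a subgraph. $d_{\mathcal{H}}(A)$ is the number of edges of $\mathcal{H}$ containing $A$. -}

module Defs where

open import Data.Nat using (ℕ; zero; suc; _+_; _*_; _∸_; _≤ᵇ_; _≡ᵇ_)
open import Data.Bool using (Bool; true; false; _∧_; if_then_else_)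
open import Data.Fin using (Fin; toℕ) renaming (zero to fzero; suc to fsuc)
open import Data.Fin.Subset using (Subset; _⊆_; _∩_; ∣_∣)
open import Data.Fin.Subset.Properties using (_⊆?_)
open import Data.Vec using (Vec; []; _∷_)
open import Data.List using (List; []; _∷_; map; _++_; filter; filterᵇ; length)
open import Data.Product using (Σ; _×_; ∃)
open import Relation.Binary.PropositionalEquality using (_≡_; _≢_)
open import Relation.Nullary using (does)

Hypergraph : ℕ → Set
Hypergraph n = Subset n → Bool

IsUniform : {n : ℕ} → ℕ → Hypergraph n → Set
IsUniform {n} k H = (E : Subset n) → H E ≡ true → ∣ E ∣ ≡ k

allSubsets : (n : ℕ) → List (Subset n)
allSubsets zero = [] ∷ []
allSubsets (suc n) = map (true ∷_) (allSubsets n) ++ map (false ∷_) (allSubsets n)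

degree : {n : ℕ} → Hypergraph n → Subset n → ℕ
degree {n} H A = length (filter (λ E → A ⊆? E) edges)
  where
  edges : List (Subset n)
  edges = filterᵇ H (allSubsets n)

ContainsSunflower : {n : ℕ} → Hypergraph n → (λ′ ℓ : ℕ) → Set
ContainsSunflower {n} H λ′ ℓ =
  Σ (Subset n) λ S → ∣ S ∣ ≡ ℓ ×
  Σ (Fin λ′ → Subset n) λ E →
    ((i : Fin λ′) → H (E i) ≡ true) ×
    ((i : Fin λ′) → S ⊆ E i) ×
    ((i j : Fin λ′) → i ≢ j → E i ∩ E j ≡ S)

HighDegree : {n : ℕ} → Hypergraph n → (m t : ℕ) → Hypergraph n
HighDegree H m t A = (∣ A ∣ ≡ᵇ m) ∧ (t ≤ᵇ degree H A)

prodFin : (m : ℕ) → (Fin m → ℕ) → ℕ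
prodFin zero f = 1
prodFin (suc m) f = f fzero * prodFin m (λ i → f (fsuc i))

-- Let the petals A₁, …, A_λ of a copy of S^m_λ(ℓ) with kernel S in a high-degree m-graph
-- be replaced, one at a time, by edges of H. When Aᵢ is processed, the other current
-- petals have at most (λ - 1)(k - |S|) vertices outside S, and an edge through Aᵢ that meets
-- such a vertex w ∉ Aᵢ contains Aᵢ ∪ {w}, whose degree is at most some M. As
-- d(Aᵢ) > (λ - 1)(k - |S|)M, some edge through Aᵢ avoids all of them, so the petals keep
-- meeting exactly in S and H ends up containing S^k_λ(ℓ).
-- For the (k-1)-graph M = 1, since a k-set lies in at most one edge. For the k'-graph the
-- same argument, applied to λ'ᵢ copies of a set B, shows that the maximal degree grows by a
-- factor of at most (i+1)λ'ᵢ from (k-i+1)-sets to (k-i)-sets: otherwise H would contain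
-- S^k_{λ'ᵢ}(k-i).

module Submission where

open import Defs
open import Data.Nat using (ℕ; zero; suc; _*_; _∸_; _≤_; _<_; _+_; _<?_; z≤n; s≤s; s≤s⁻¹; pred; >-nonZero)
open import Data.Nat.Properties
  using (≤-refl; ≤-trans; ≤-reflexive; n≤1+n; m≤n⇒m≤1+n; +-mono-≤; +-suc; <⇒≱; +-identityʳ;
         +-monoˡ-≤; +-monoʳ-≤; +-assoc; m≤m+n; ≤⇒≯; ≡ᵇ⇒≡; ≤ᵇ⇒≤; m+n≤o⇒m≤o∸n; *-monoˡ-≤; ≤-<-trans;
         *-comm; *-assoc; *-mono-≤; ≮⇒≥; pred[n]≤n; m∸[m∸n]≡n; +-∸-assoc; <-trans; n<1+n; m∸n≤m;
         *-monoʳ-≤; *-monoˡ-<; *-monoʳ-<; ≤∧≢⇒<; <⇒≤; <-irrefl; m+[n∸m]≡n; *-identityʳ; +-comm;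
         ∸-monoʳ-<; ∸-+-assoc; m≤n+m; module ≤-Reasoning)
open import Data.Bool using (true; T?)
open import Data.Bool.Properties using (T-∧; T-≡)
open import Data.Fin using (Fin; toℕ; fromℕ; fromℕ<; inject₁; punchIn; punchOut)
  renaming (zero to fzero; suc to fsuc)
open import Data.Fin.Properties
  using (toℕ-fromℕ; toℕ-fromℕ<; toℕ-inject₁; toℕ-injective; toℕ<n; punchIn-punchOut; _≟_)
open import Data.Fin.Subset using (Subset; _∈_; _∉_; _⊆_; _∩_; _∪_; _─_; ⁅_⁆; ∣_∣; inside; outside)
open import Data.Fin.Subset.Properties
  using (_∈?_; _⊆?_; ⊆-antisym; p⊂q⇒∣p∣<∣q∣; x∈p∩q⁺; x∈p∩q⁻; x∈p∪q⁻; x∈⁅y⁆⇒x≡y; x∈p∧x∉q⇒x∈p─q;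
         ∪-identityʳ; drop-∷-⊆; drop-not-there)
open import Data.List using (List; []; _∷_; length; map; filter; filterᵇ; concatMap; allFin; _++_)
open import Data.List.Properties using (length-map; length-++; length-tabulate; filter-accept)
open import Data.List.Membership.Propositional using () renaming (_∈_ to _∈ₗ_)
open import Data.List.Membership.Propositional.Properties
  using (∈-map⁺; ∈-map⁻; ∈-filter⁻; ∈-concatMap⁺; ∈-allFin)
open import Data.List.Relation.Unary.All as All using (All; []; _∷_; all?)
open import Data.List.Relation.Unary.Any as Any using ()
open import Data.List.Relation.Unary.AllPairs using ([]; _∷_)
open import Data.List.Relation.Unary.Unique.Propositional using (Unique)
open import Data.List.Relation.Unary.Unique.Propositional.Properties using (map⁺; ++⁺; filter⁺)
open import Data.Product using (∃; _×_; _,_; proj₁; proj₂)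
open import Data.Sum using (_⊎_; inj₁; inj₂; [_,_])
open import Data.Vec using ([]; _∷_; here; there)
open import Data.Vec.Properties using (∷-injectiveʳ)
open import Data.Vec.Functional using (updateAt)
open import Data.Vec.Functional.Properties using (updateAt-updates; updateAt-minimal)
open import Function using (_∘_; id; const; Equivalence)
open import Relation.Binary.PropositionalEquality using (_≡_; _≢_; refl; sym; trans; cong; cong₂; subst)
open import Relation.Nullary using (¬_; Dec; yes; no; contradiction)
open import Relation.Nullary.Decidable using (_×-dec_; _→-dec_)
open import Relation.Unary using (Pred; Decidable)

module _ {a} {A : Set a} where

  length-filter-∷ : ∀ {p} {P : Pred A p} (P? : Decidable P) x xs →
    length (filter P? xs) ≤ length (filter P? (x ∷ xs))
  length-filter-∷ P? x xs with P? x
  ... | yes _ = n≤1+n _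
  ... | no _ = ≤-refl

  length-filter-mono : ∀ {p q} {P : Pred A p} {Q : Pred A q} (P? : Decidable P) (Q? : Decidable Q) →
    (∀ {x} → P x → Q x) → ∀ xs → length (filter P? xs) ≤ length (filter Q? xs)
  length-filter-mono P? Q? P⇒Q [] = z≤n
  length-filter-mono P? Q? P⇒Q (x ∷ xs) with P? x | Q? x
  ... | yes _  | yes _   = s≤s (length-filter-mono P? Q? P⇒Q xs)
  ... | yes px | no ¬qx  = contradiction (P⇒Q px) ¬qx
  ... | no _   | yes _   = m≤n⇒m≤1+n (length-filter-mono P? Q? P⇒Q xs)
  ... | no _   | no _    = length-filter-mono P? Q? P⇒Q xs

  length-filter-≤-+ : ∀ {p q r} {P : Pred A p} {Q : Pred A q} {R : Pred A r}
    (P? : Decidable P) (Q? : Decidable Q) (R? : Decidable R) → (∀ {x} → P x → Q x ⊎ R x) →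
    ∀ xs → length (filter P? xs) ≤ length (filter Q? xs) + length (filter R? xs)
  length-filter-≤-+ P? Q? R? split [] = z≤n
  length-filter-≤-+ P? Q? R? split (x ∷ xs) with ih ← length-filter-≤-+ P? Q? R? split xs | P? x
  ... | no _ = ≤-trans ih (+-mono-≤ (length-filter-∷ Q? x xs) (length-filter-∷ R? x xs))
  ... | yes px with split px
  ...   | inj₁ qx = ≤-trans (s≤s ih)
            (+-mono-≤ (≤-reflexive (cong length (sym (filter-accept Q? qx)))) (length-filter-∷ R? x xs))
  ...   | inj₂ rx = ≤-trans (s≤s ih) (≤-trans (≤-reflexive (sym (+-suc _ _)))
            (+-mono-≤ (length-filter-∷ Q? x xs) (≤-reflexive (cong length (sym (filter-accept R? rx))))))

  ∃-from-length-filter : ∀ {p} {P : Pred A p} (P? : Decidable P) xs →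
    0 < length (filter P? xs) → ∃ λ x → x ∈ₗ xs × P x
  ∃-from-length-filter P? (x ∷ xs) pos with P? x
  ... | yes px = x , Any.here refl , px
  ... | no _ with ∃-from-length-filter P? xs pos
  ...   | y , y∈xs , py = y , Any.there y∈xs , py

  Unique∧All≡⇒length≤1 : ∀ {x : A} {xs} → Unique xs → All (_≡ x) xs → length xs ≤ 1
  Unique∧All≡⇒length≤1 [] [] = z≤n
  Unique∧All≡⇒length≤1 (_ ∷ _) (_ ∷ []) = ≤-refl
  Unique∧All≡⇒length≤1 ((y≢z ∷ _) ∷ _) (refl ∷ refl ∷ _) = contradiction refl y≢z

  length-concatMap-≤ : ∀ {b} {B : Set b} (f : A → List B) {c} → (∀ x → length (f x) ≤ c) →
    ∀ xs → length (concatMap f xs) ≤ length xs * c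
  length-concatMap-≤ f bound [] = z≤n
  length-concatMap-≤ f bound (x ∷ xs) = begin
    length (f x ++ concatMap f xs)           ≡⟨ length-++ (f x) ⟩
    length (f x) + length (concatMap f xs)   ≤⟨ +-mono-≤ (bound x) (length-concatMap-≤ f bound xs) ⟩
    _                                        ∎
    where open ≤-Reasoning

elements : ∀ {n} → Subset n → List (Fin n)
elements [] = []
elements (inside ∷ p) = fzero ∷ map fsuc (elements p)
elements (outside ∷ p) = map fsuc (elements p)

∈-elements : ∀ {n} {x : Fin n} p → x ∈ p → x ∈ₗ elements p
∈-elements (inside ∷ p) here = Any.here refl
∈-elements (inside ∷ p) (there x∈p) = Any.there (∈-map⁺ fsuc (∈-elements p x∈p))
∈-elements (outside ∷ p) (there x∈p) = ∈-map⁺ fsuc (∈-elements p x∈p)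

length-elements : ∀ {n} (p : Subset n) → length (elements p) ≡ ∣ p ∣
length-elements [] = refl
length-elements (inside ∷ p) = cong suc (trans (length-map fsuc (elements p)) (length-elements p))
length-elements (outside ∷ p) = trans (length-map fsuc (elements p)) (length-elements p)

∣p∪⁅x⁆∣≡1+∣p∣ : ∀ {n} {x : Fin n} p → x ∉ p → ∣ p ∪ ⁅ x ⁆ ∣ ≡ suc ∣ p ∣
∣p∪⁅x⁆∣≡1+∣p∣ {x = fzero} (inside ∷ p) x∉p = contradiction here x∉p
∣p∪⁅x⁆∣≡1+∣p∣ {x = fzero} (outside ∷ p) _ = cong (suc ∘ ∣_∣) (∪-identityʳ p)
∣p∪⁅x⁆∣≡1+∣p∣ {x = fsuc x} (inside ∷ p) x∉p = cong suc (∣p∪⁅x⁆∣≡1+∣p∣ p (drop-not-there x∉p))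
∣p∪⁅x⁆∣≡1+∣p∣ {x = fsuc x} (outside ∷ p) x∉p = ∣p∪⁅x⁆∣≡1+∣p∣ p (drop-not-there x∉p)

∣p─q∣+∣q∣≡∣p∣ : ∀ {n} {p q : Subset n} → q ⊆ p → ∣ p ─ q ∣ + ∣ q ∣ ≡ ∣ p ∣
∣p─q∣+∣q∣≡∣p∣ {p = []} {[]} _ = refl
∣p─q∣+∣q∣≡∣p∣ {p = inside ∷ p} {inside ∷ q} q⊆p = trans (+-suc _ _) (cong suc (∣p─q∣+∣q∣≡∣p∣ (drop-∷-⊆ q⊆p)))
∣p─q∣+∣q∣≡∣p∣ {p = inside ∷ p} {outside ∷ q} q⊆p = cong suc (∣p─q∣+∣q∣≡∣p∣ (drop-∷-⊆ q⊆p))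
∣p─q∣+∣q∣≡∣p∣ {p = outside ∷ p} {outside ∷ q} q⊆p = ∣p─q∣+∣q∣≡∣p∣ (drop-∷-⊆ q⊆p)
∣p─q∣+∣q∣≡∣p∣ {p = outside ∷ p} {inside ∷ q} q⊆p with q⊆p here
... | ()

⊆∧∣∣≤⇒≡ : ∀ {n} {p q : Subset n} → p ⊆ q → ∣ q ∣ ≤ ∣ p ∣ → p ≡ q
⊆∧∣∣≤⇒≡ {p = p} {q} p⊆q ∣q∣≤∣p∣ = ⊆-antisym p⊆q q⊆p
  where
  q⊆p : q ⊆ p
  q⊆p {x} x∈q with x ∈? p
  ... | yes x∈p = x∈p
  ... | no x∉p = contradiction (p⊂q⇒∣p∣<∣q∣ (p⊆q , x , x∈q , x∉p)) (≤⇒≯ ∣q∣≤∣p∣)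

∪⁅⁆-⊆ : ∀ {n} {p q : Subset n} {x} → p ⊆ q → x ∈ q → p ∪ ⁅ x ⁆ ⊆ q
∪⁅⁆-⊆ {p = p} {x = x} p⊆q x∈q y∈ =
  [ p⊆q , (λ y∈⁅x⁆ → subst (_∈ _) (sym (x∈⁅y⁆⇒x≡y x y∈⁅x⁆)) x∈q) ] (x∈p∪q⁻ p ⁅ x ⁆ y∈)

allSubsets-unique : ∀ n → Unique (allSubsets n)
allSubsets-unique zero = [] ∷ []
allSubsets-unique (suc n) = ++⁺ (map⁺ ∷-injectiveʳ u) (map⁺ ∷-injectiveʳ u) disjoint
  where
  u = allSubsets-unique n
  disjoint : ∀ {v} → ¬ (v ∈ₗ map (inside ∷_) (allSubsets n) × v ∈ₗ map (outside ∷_) (allSubsets n))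
  disjoint (v∈ᵢ , v∈ₒ) with ∈-map⁻ (inside ∷_) v∈ᵢ | ∈-map⁻ (outside ∷_) v∈ₒ
  ... | _ , _ , refl | _ , _ , ()

edges : ∀ {n} → Hypergraph n → List (Subset n)
edges {n} H = filterᵇ H (allSubsets n)

∈-edges⇒edge : ∀ {n} {H : Hypergraph n} {E} → E ∈ₗ edges H → H E ≡ true
∈-edges⇒edge {n} {H} E∈ = Equivalence.to T-≡ (proj₂ (∈-filter⁻ (T? ∘ H) {xs = allSubsets n} E∈))

degree-≤1 : ∀ {n k} {H : Hypergraph n} → IsUniform k H → ∀ {X} → ∣ X ∣ ≡ k → degree H X ≤ 1
degree-≤1 {n} {H = H} uniform {X} ∣X∣≡k =
  Unique∧All≡⇒length≤1 (filter⁺ (X ⊆?_) (filter⁺ (T? ∘ H) (allSubsets-unique n))) (All.tabulate edge≡X)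
  where
  edge≡X : ∀ {E} → E ∈ₗ filter (X ⊆?_) (edges H) → E ≡ X
  edge≡X E∈ with ∈-filter⁻ (X ⊆?_) {xs = edges H} E∈
  ... | E∈edges , X⊆E =
    sym (⊆∧∣∣≤⇒≡ X⊆E (≤-reflexive (trans (uniform _ (∈-edges⇒edge E∈edges)) (sym ∣X∣≡k))))

HighDegree⇒size∧degree : ∀ {n} (H : Hypergraph n) {m t A} → HighDegree H m t A ≡ true →
  ∣ A ∣ ≡ m × t ≤ degree H A
HighDegree⇒size∧degree H {m} {t} {A} high with Equivalence.to T-∧ (Equivalence.from T-≡ high)
... | size , deg = ≡ᵇ⇒≡ ∣ A ∣ m size , ≤ᵇ⇒≤ t (degree H A) deg

Avoids : ∀ {n} → Subset n → List (Fin n) → Subset n → Set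
Avoids A ws E = All (λ w → w ∈ E → w ∈ A) ws

avoids? : ∀ {n} (A : Subset n) ws → Decidable (λ E → A ⊆ E × Avoids A ws E)
avoids? A ws E = A ⊆? E ×-dec all? (λ w → w ∈? E →-dec w ∈? A) ws

module _ {n} (H : Hypergraph n) where

  avoiders : Subset n → List (Fin n) → ℕ
  avoiders A ws = length (filter (avoids? A ws) (edges {n} H))

  degree-≤-avoiders : ∀ {A M} → (∀ w → w ∉ A → degree H (A ∪ ⁅ w ⁆) ≤ M) →
    ∀ ws → degree H A ≤ avoiders A ws + length ws * M
  degree-≤-avoiders {A} bound [] = begin
    degree H A      ≤⟨ length-filter-mono (A ⊆?_) (avoids? A []) (_, []) (edges {n} H) ⟩
    avoiders A []   ≡⟨ sym (+-identityʳ (avoiders A [])) ⟩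
    avoiders A [] + 0 ∎
    where open ≤-Reasoning
  degree-≤-avoiders {A} {M} bound (w ∷ ws) = begin
    degree H A                               ≤⟨ degree-≤-avoiders bound ws ⟩
    avoiders A ws + length ws * M            ≤⟨ +-monoˡ-≤ (length ws * M) avoiders-∷ ⟩
    avoiders A (w ∷ ws) + M + length ws * M  ≡⟨ +-assoc (avoiders A (w ∷ ws)) M (length ws * M) ⟩
    avoiders A (w ∷ ws) + length (w ∷ ws) * M ∎
    where
    open ≤-Reasoning
    avoiders-∷ : avoiders A ws ≤ avoiders A (w ∷ ws) + M
    avoiders-∷ = by-cases (w ∈? A)
      where
      by-cases : Dec (w ∈ A) → avoiders A ws ≤ avoiders A (w ∷ ws) + M
      by-cases (yes w∈A) = ≤-trans
        (length-filter-mono (avoids? A ws) (avoids? A (w ∷ ws))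
          (λ (A⊆E , av) → A⊆E , (λ _ → w∈A) ∷ av) (edges {n} H))
        (m≤m+n (avoiders A (w ∷ ws)) M)
      by-cases (no w∉A) = ≤-trans
        (length-filter-≤-+ (avoids? A ws) (avoids? A (w ∷ ws)) ((A ∪ ⁅ w ⁆) ⊆?_) split (edges {n} H))
        (+-monoʳ-≤ (avoiders A (w ∷ ws)) (bound w w∉A))
        where
        split : ∀ {E} → A ⊆ E × Avoids A ws E → A ⊆ E × Avoids A (w ∷ ws) E ⊎ A ∪ ⁅ w ⁆ ⊆ E
        split {E} (A⊆E , av) with w ∈? E
        ... | yes w∈E = inj₂ (∪⁅⁆-⊆ A⊆E w∈E)
        ... | no w∉E = inj₁ (A⊆E , (λ w∈E → contradiction w∈E w∉E) ∷ av)

IsSunflower : ∀ {n q} → Subset n → (Fin q → Subset n) → Set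
IsSunflower S G = (∀ i → S ⊆ G i) × (∀ {i j x} → i ≢ j → x ∈ G i → x ∈ G j → x ∈ S)

IsSunflower⇒∩≡ : ∀ {n q} {S : Subset n} {G : Fin q → Subset n} → IsSunflower S G →
  ∀ i j → i ≢ j → G i ∩ G j ≡ S
IsSunflower⇒∩≡ {G = G} (S⊆G , meet) i j i≢j = ⊆-antisym
  (λ x∈ → let x∈Gi , x∈Gj = x∈p∩q⁻ (G i) (G j) x∈ in meet i≢j x∈Gi x∈Gj)
  (λ x∈S → x∈p∩q⁺ (S⊆G i x∈S , S⊆G j x∈S))

∩≡⇒IsSunflower : ∀ {n q} {S : Subset n} {G : Fin q → Subset n} → (∀ i → S ⊆ G i) →
  (∀ i j → i ≢ j → G i ∩ G j ≡ S) → IsSunflower S G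
∩≡⇒IsSunflower S⊆G ∩≡S = S⊆G , λ {i} {j} i≢j x∈Gi x∈Gj → subst (_ ∈_) (∩≡S i j i≢j) (x∈p∩q⁺ (x∈Gi , x∈Gj))

IsSunflower-const : ∀ {n q} (B : Subset n) → IsSunflower {q = q} B (const B)
IsSunflower-const B = (λ _ → id) , (λ _ x∈B _ → x∈B)

updateAt-const : ∀ {q} {A : Set} (G : Fin q → A) i E a →
  a ≡ i × updateAt G i (const E) a ≡ E ⊎ a ≢ i × updateAt G i (const E) a ≡ G a
updateAt-const G i E a with a ≟ i
... | yes refl = inj₁ (refl , updateAt-updates i G)
... | no a≢i = inj₂ (a≢i , updateAt-minimal a i G a≢i)

IsSunflower-updateAt : ∀ {n q} {S E : Subset n} {G : Fin q → Subset n} {i} → IsSunflower S G → S ⊆ E →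
  (∀ {j x} → j ≢ i → x ∈ E → x ∈ G j → x ∈ S) → IsSunflower S (updateAt G i (const E))
IsSunflower-updateAt {S = S} {E} {G} {i} (S⊆G , meet) S⊆E meetE = S⊆G′ , meet′
  where
  G′ = updateAt G i (const E)
  S⊆G′ : ∀ a → S ⊆ G′ a
  S⊆G′ a with updateAt-const G i E a
  ... | inj₁ (_ , eq) = subst (S ⊆_) (sym eq) S⊆E
  ... | inj₂ (_ , eq) = subst (S ⊆_) (sym eq) (S⊆G a)
  meet′ : ∀ {a b x} → a ≢ b → x ∈ G′ a → x ∈ G′ b → x ∈ S
  meet′ {a} {b} {x} a≢b x∈a x∈b with updateAt-const G i E a | updateAt-const G i E b
  ... | inj₁ (refl , _)  | inj₁ (refl , _)  = contradiction refl a≢b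
  ... | inj₁ (refl , ea) | inj₂ (b≢i , eb)  = meetE b≢i (subst (x ∈_) ea x∈a) (subst (x ∈_) eb x∈b)
  ... | inj₂ (a≢i , ea)  | inj₁ (refl , eb) = meetE a≢i (subst (x ∈_) eb x∈b) (subst (x ∈_) ea x∈a)
  ... | inj₂ (_ , ea)    | inj₂ (_ , eb)    = meet a≢b (subst (x ∈_) ea x∈a) (subst (x ∈_) eb x∈b)

module _ {n k} {H : Hypergraph n} (uniform : IsUniform k H) (S : Subset n) where

  outerVertices : ∀ {p} → (Fin (suc p) → Subset n) → Fin (suc p) → List (Fin n)
  outerVertices {p} G i = concatMap (λ j → elements (G (punchIn i j) ─ S)) (allFin p)

  ∈-outerVertices : ∀ {p} {G : Fin (suc p) → Subset n} {i j x} → j ≢ i → x ∈ G j → x ∉ S →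
    x ∈ₗ outerVertices G i
  ∈-outerVertices {p} {G} {i} {j} {x} j≢i x∈Gj x∉S =
    ∈-concatMap⁺ (λ j → elements (G (punchIn i j) ─ S))
      (Any.map (λ { refl → ∈-elements _ x∈G′─S }) (∈-allFin j′))
    where
    j′ = punchOut (j≢i ∘ sym)
    x∈G′─S : x ∈ G (punchIn i j′) ─ S
    x∈G′─S = x∈p∧x∉q⇒x∈p─q (subst (λ a → x ∈ G a) (sym (punchIn-punchOut (j≢i ∘ sym))) x∈Gj) x∉S

  length-outerVertices : ∀ {p} {G : Fin (suc p) → Subset n} → IsSunflower S G → (∀ j → ∣ G j ∣ ≤ k) →
    ∀ i → length (outerVertices G i) ≤ p * (k ∸ ∣ S ∣)
  length-outerVertices {p} {G} (S⊆G , _) small i = begin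
    length (outerVertices G i)
      ≤⟨ length-concatMap-≤ (λ j → elements (G (punchIn i j) ─ S)) petal (allFin p) ⟩
    length (allFin p) * (k ∸ ∣ S ∣)
      ≡⟨ cong (_* (k ∸ ∣ S ∣)) (length-tabulate {n = p} id) ⟩
    p * (k ∸ ∣ S ∣)
      ∎
    where
    open ≤-Reasoning
    petal : ∀ j → length (elements (G (punchIn i j) ─ S)) ≤ k ∸ ∣ S ∣
    petal j = subst (_≤ k ∸ ∣ S ∣) (sym (length-elements (Gⱼ ─ S)))
      (m+n≤o⇒m≤o∸n ∣ Gⱼ ─ S ∣ (≤-trans (≤-reflexive (∣p─q∣+∣q∣≡∣p∣ (S⊆G (punchIn i j)))) (small (punchIn i j))))
      where Gⱼ = G (punchIn i j)

  replacePetal : ∀ {q M} {G : Fin q → Subset n} → IsSunflower S G → (∀ j → ∣ G j ∣ ≤ k) → ∀ i →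
    (∀ w → w ∉ G i → degree H (G i ∪ ⁅ w ⁆) ≤ M) → pred q * (k ∸ ∣ S ∣) * M < degree H (G i) →
    ∃ λ E → H E ≡ true × IsSunflower S (updateAt G i (const E))
  replacePetal {suc p} {M} {G} sunflower@(S⊆G , meet) small i bound heavy =
    extendTo (∃-from-length-filter (avoids? (G i) ws) (edges H)
      (positive (degree-≤-avoiders H bound ws) few))
    where
    ws = outerVertices G i
    few : length ws * M < degree H (G i)
    few = ≤-<-trans (*-monoˡ-≤ M (length-outerVertices sunflower small i)) heavy
    positive : ∀ {d a b} → d ≤ a + b → b < d → 0 < a
    positive {a = zero} d≤b b<d = contradiction d≤b (<⇒≱ b<d)
    positive {a = suc _} _ _ = s≤s z≤n
    extendTo : (∃ λ E → E ∈ₗ edges H × G i ⊆ E × Avoids (G i) ws E) →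
      ∃ λ E → H E ≡ true × IsSunflower S (updateAt G i (const E))
    extendTo (E , E∈edges , Gi⊆E , avoids) =
      E , ∈-edges⇒edge E∈edges , IsSunflower-updateAt sunflower (λ x∈S → Gi⊆E (S⊆G i x∈S)) meetE
      where
      meetE : ∀ {j x} → j ≢ i → x ∈ E → x ∈ G j → x ∈ S
      meetE {j} {x} j≢i x∈E x∈Gj with x ∈? S
      ... | yes x∈S = x∈S
      ... | no x∉S = meet (j≢i ∘ sym) (All.lookup avoids (∈-outerVertices {G = G} j≢i x∈Gj x∉S) x∈E) x∈Gj

  module _ {q M} (A : Fin q → Subset n) (sunflower : IsSunflower S A) (small : ∀ i → ∣ A i ∣ ≤ k)
    (bound : ∀ i w → w ∉ A i → degree H (A i ∪ ⁅ w ⁆) ≤ M)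
    (heavy : ∀ i → pred q * (k ∸ ∣ S ∣) * M < degree H (A i)) where

    Stage : ℕ → (Fin q → Subset n) → Set
    Stage t G = IsSunflower S G × (∀ i → toℕ i < t → H (G i) ≡ true) × (∀ i → t ≤ toℕ i → G i ≡ A i)

    Stage⇒small : ∀ {t G} → Stage t G → ∀ i → ∣ G i ∣ ≤ k
    Stage⇒small {t} (_ , done , todo) i with toℕ i <? t
    ... | yes i<t = ≤-reflexive (uniform _ (done i i<t))
    ... | no i≮t = subst (λ B → ∣ B ∣ ≤ k) (sym (todo i (≮⇒≥ i≮t))) (small i)

    Stage-suc : ∀ {t G} → t < q → Stage t G → ∃ (Stage (suc t))
    Stage-suc {t} {G} t<q stage@(sunflowerG , done , todo) =
      next (replacePetal sunflowerG (Stage⇒small stage) i boundᵢ heavyᵢ)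
      where
      i = fromℕ< t<q
      toℕi≡t : toℕ i ≡ t
      toℕi≡t = toℕ-fromℕ< t<q
      Gi≡Ai : G i ≡ A i
      Gi≡Ai = todo i (≤-reflexive (sym toℕi≡t))
      boundᵢ : ∀ w → w ∉ G i → degree H (G i ∪ ⁅ w ⁆) ≤ M
      boundᵢ rewrite Gi≡Ai = bound i
      heavyᵢ : pred q * (k ∸ ∣ S ∣) * M < degree H (G i)
      heavyᵢ rewrite Gi≡Ai = heavy i
      next : (∃ λ E → H E ≡ true × IsSunflower S (updateAt G i (const E))) → ∃ (Stage (suc t))
      next (E , edge , sunflower′) = updateAt G i (const E) , sunflower′ , done′ , todo′
        where
        done′ : ∀ a → toℕ a < suc t → H (updateAt G i (const E) a) ≡ true
        done′ a a≤t with updateAt-const G i E a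
        ... | inj₁ (_ , eq) = subst (λ B → H B ≡ true) (sym eq) edge
        ... | inj₂ (a≢i , eq) = subst (λ B → H B ≡ true) (sym eq) (done a a<t)
          where
          a<t : toℕ a < t
          a<t = ≤∧≢⇒< (s≤s⁻¹ a≤t) (λ e → a≢i (toℕ-injective (trans e (sym toℕi≡t))))
        todo′ : ∀ a → suc t ≤ toℕ a → updateAt G i (const E) a ≡ A a
        todo′ a t<a = trans (updateAt-minimal a i G a≢i) (todo a (<⇒≤ t<a))
          where
          a≢i : a ≢ i
          a≢i refl = <-irrefl (sym toℕi≡t) t<a

    Stage-reachable : ∀ t → t ≤ q → ∃ (Stage t)
    Stage-reachable zero _ = A , sunflower , (λ _ ()) , (λ _ _ → refl)
    Stage-reachable (suc t) t<q with Stage-reachable t (<⇒≤ t<q)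
    ... | _ , stage = Stage-suc t<q stage

    extendToSunflower : ContainsSunflower H q ∣ S ∣
    extendToSunflower with Stage-reachable q ≤-refl
    ... | G , sunflowerG@(S⊆G , _) , done , _ =
      S , refl , G , (λ i → done i (toℕ<n i)) , S⊆G , IsSunflower⇒∩≡ sunflowerG

prodFin-cong : ∀ N {f g : Fin N → ℕ} → (∀ i → f i ≡ g i) → prodFin N f ≡ prodFin N g
prodFin-cong zero f≗g = refl
prodFin-cong (suc N) f≗g = cong₂ _*_ (f≗g fzero) (prodFin-cong N (f≗g ∘ fsuc))

prodFin-snoc : ∀ N (f : Fin (suc N) → ℕ) → prodFin (suc N) f ≡ prodFin N (f ∘ inject₁) * f (fromℕ N)
prodFin-snoc zero f = *-comm (f fzero) 1
prodFin-snoc (suc N) f = trans (cong (f fzero *_) (prodFin-snoc N (f ∘ fsuc))) (sym (*-assoc (f fzero) _ _))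

prodFin-positive : ∀ N (f : Fin N → ℕ) → (∀ i → 1 ≤ f i) → 1 ≤ prodFin N f
prodFin-positive zero f _ = ≤-refl
prodFin-positive (suc N) f f≥1 = *-mono-≤ (f≥1 fzero) (prodFin-positive N (f ∘ fsuc) (f≥1 ∘ fsuc))

module _ {n k} {H : Hypergraph n} (uniform : IsUniform k H) where

  degree-bound : ∀ N → N < k → (μ : Fin N → ℕ) →
    (∀ i → ¬ ContainsSunflower H (μ i) (k ∸ suc (toℕ i))) →
    ∀ {B} → ∣ B ∣ ≡ k ∸ N → degree H B ≤ prodFin N (λ i → (toℕ i + 2) * μ i)
  degree-bound zero _ _ _ ∣B∣≡k = degree-≤1 uniform ∣B∣≡k
  degree-bound (suc N) 1+N<k μ free {B} ∣B∣≡ = begin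
    degree H B                 ≤⟨ ≮⇒≥ (free (fromℕ N) ∘ copiesOfB) ⟩
    pred μN * suc N * M        ≤⟨ *-monoˡ-≤ M (*-mono-≤ (pred[n]≤n {μN}) 1+N≤N+2) ⟩
    μN * (N + 2) * M           ≡⟨ *-comm (μN * (N + 2)) M ⟩
    M * (μN * (N + 2))         ≡⟨ cong (M *_) (*-comm μN (N + 2)) ⟩
    M * ((N + 2) * μN)         ≡⟨ sym product ⟩
    prodFin (suc N) (λ i → (toℕ i + 2) * μ i) ∎
    where
    open ≤-Reasoning
    μN = μ (fromℕ N)
    M = prodFin N (λ i → (toℕ i + 2) * μ (inject₁ i))
    1+N≤N+2 : suc N ≤ N + 2
    1+N≤N+2 = ≤-trans (n≤1+n (suc N)) (≤-reflexive (+-comm 2 N))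
    product : prodFin (suc N) (λ i → (toℕ i + 2) * μ i) ≡ M * ((N + 2) * μN)
    product = trans (prodFin-snoc N (λ i → (toℕ i + 2) * μ i)) (cong₂ _*_
      (prodFin-cong N (λ i → cong (λ m → (m + 2) * μ (inject₁ i)) (toℕ-inject₁ i)))
      (cong (λ m → (m + 2) * μN) (toℕ-fromℕ N)))
    bound : ∀ {B′} → ∣ B′ ∣ ≡ k ∸ N → degree H B′ ≤ M
    bound = degree-bound N (<-trans (n<1+n N) 1+N<k) (μ ∘ inject₁)
      (λ i → subst (λ m → ¬ ContainsSunflower H (μ (inject₁ i)) (k ∸ suc m))
               (toℕ-inject₁ i) (free (inject₁ i)))
    ∣B∪⁅w⁆∣≡ : ∀ {w} → w ∉ B → ∣ B ∪ ⁅ w ⁆ ∣ ≡ k ∸ N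
    ∣B∪⁅w⁆∣≡ w∉B = trans (∣p∪⁅x⁆∣≡1+∣p∣ B w∉B) (trans (cong suc ∣B∣≡) (sym (+-∸-assoc 1 (<⇒≤ 1+N<k))))
    k∸∣B∣≡ : k ∸ ∣ B ∣ ≡ suc N
    k∸∣B∣≡ = trans (cong (k ∸_) ∣B∣≡) (m∸[m∸n]≡n (<⇒≤ 1+N<k))
    copiesOfB : pred μN * suc N * M < degree H B → ContainsSunflower H μN (k ∸ suc (toℕ (fromℕ N)))
    copiesOfB heavy =
      subst (ContainsSunflower H μN) (trans ∣B∣≡ (cong (λ m → k ∸ suc m) (sym (toℕ-fromℕ N))))
        (extendToSunflower uniform B (const B) (IsSunflower-const B)
          (λ _ → subst (_≤ k) (sym ∣B∣≡) (m∸n≤m k (suc N)))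
          (λ _ _ w∉B → bound (∣B∪⁅w⁆∣≡ w∉B))
          (λ _ → subst (λ c → pred μN * c * M < degree H B) (sym k∸∣B∣≡) heavy))

  highDegreeSunflower⇒sunflower : ∀ {m t M p ℓ} → 1 ≤ k → m ≤ k → 1 ≤ M →
    (∀ {B} → ∣ B ∣ ≡ suc m → degree H B ≤ M) → k * suc p * M ≤ t →
    ContainsSunflower (HighDegree H m t) (suc p) ℓ → ContainsSunflower H (suc p) ℓ
  highDegreeSunflower⇒sunflower {m} {t} {M} {p} 1≤k m≤k 1≤M bound t≥ (S , refl , A , high , S⊆A , ∩≡S) =
    extendToSunflower uniform S A (∩≡⇒IsSunflower S⊆A ∩≡S) small boundᵢ heavy
    where
    size : ∀ i → ∣ A i ∣ ≡ m
    size i = proj₁ (HighDegree⇒size∧degree H {m} {t} {A i} (high i))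
    small : ∀ i → ∣ A i ∣ ≤ k
    small i = subst (_≤ k) (sym (size i)) m≤k
    boundᵢ : ∀ i w → w ∉ A i → degree H (A i ∪ ⁅ w ⁆) ≤ M
    boundᵢ i w w∉Ai = bound (trans (∣p∪⁅x⁆∣≡1+∣p∣ (A i) w∉Ai) (cong suc (size i)))
    heavy : ∀ i → p * (k ∸ ∣ S ∣) * M < degree H (A i)
    heavy i = begin-strict
      p * (k ∸ ∣ S ∣) * M   ≤⟨ *-monoˡ-≤ M (*-monoʳ-≤ p (m∸n≤m k ∣ S ∣)) ⟩
      p * k * M             ≡⟨ cong (_* M) (*-comm p k) ⟩
      k * p * M             <⟨ *-monoˡ-< M {{>-nonZero 1≤M}} (*-monoʳ-< k {{>-nonZero 1≤k}} (n<1+n p)) ⟩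
      k * suc p * M         ≤⟨ t≥ ⟩
      t                     ≤⟨ proj₂ (HighDegree⇒size∧degree H {m} {t} {A i} (high i)) ⟩
      degree H (A i)        ∎
      where open ≤-Reasoning

k∸k′∸1<k×k∸[k∸k′∸1]≡1+k′ : ∀ {k k′} → 1 ≤ k → k′ ≤ k ∸ 2 → k ∸ k′ ∸ 1 < k × k ∸ (k ∸ k′ ∸ 1) ≡ suc k′
k∸k′∸1<k×k∸[k∸k′∸1]≡1+k′ {suc k} {k′} _ k′≤k∸1 =
  subst (_< suc k) (sym N≡) (∸-monoʳ-< (s≤s z≤n) 1+k′≤1+k) , trans (cong (suc k ∸_) N≡) (m∸[m∸n]≡n 1+k′≤1+k)
  where
  1+k′≤1+k : suc k′ ≤ suc k
  1+k′≤1+k = s≤s (≤-trans k′≤k∸1 (m∸n≤m k 1))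
  N≡ : suc k ∸ k′ ∸ 1 ≡ suc k ∸ suc k′
  N≡ = trans (∸-+-assoc (suc k) k′ 1) (cong (suc k ∸_) (+-comm k′ 1))

lemma3p2 : (n k ℓ λ′ : ℕ) → 1 ≤ ℓ → ℓ < k → 2 ≤ λ′ →
    (H : Hypergraph n) → IsUniform k H → ¬ ContainsSunflower H λ′ ℓ →
    (¬ ContainsSunflower (HighDegree H (k ∸ 1) (k * λ′)) λ′ ℓ)
    × ((k′ : ℕ) → ℓ < k′ → k′ ≤ k ∸ 2 →
       (μ : Fin (k ∸ k′ ∸ 1) → ℕ) → ((i : Fin (k ∸ k′ ∸ 1)) → 1 ≤ μ i) →
       ((i : Fin (k ∸ k′ ∸ 1)) → ¬ ContainsSunflower H (μ i) (k ∸ suc (toℕ i))) →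
       ¬ ContainsSunflower
           (HighDegree H k′ (k * λ′ * prodFin (k ∸ k′ ∸ 1) (λ i → (toℕ i + 2) * μ i)))
           λ′ ℓ)
lemma3p2 n k ℓ (suc p) _ ℓ<k _ H uniform free =
  free ∘ lift₁ , λ k′ _ k′≤k∸2 μ μ≥1 μ-free → free ∘ lift₂ k′≤k∸2 μ μ≥1 μ-free
  where
  1≤k : 1 ≤ k
  1≤k = ≤-trans (s≤s z≤n) ℓ<k
  lift₁ : ContainsSunflower (HighDegree H (k ∸ 1) (k * suc p)) (suc p) ℓ → ContainsSunflower H (suc p) ℓ
  lift₁ = highDegreeSunflower⇒sunflower uniform 1≤k (m∸n≤m k 1) ≤-refl
    (λ ∣B∣≡ → degree-≤1 uniform (trans ∣B∣≡ (m+[n∸m]≡n 1≤k))) (≤-reflexive (*-identityʳ (k * suc p)))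
  lift₂ : ∀ {k′} → k′ ≤ k ∸ 2 → (μ : Fin (k ∸ k′ ∸ 1) → ℕ) → (∀ i → 1 ≤ μ i) →
    (∀ i → ¬ ContainsSunflower H (μ i) (k ∸ suc (toℕ i))) →
    ContainsSunflower (HighDegree H k′ (k * suc p * prodFin (k ∸ k′ ∸ 1) (λ i → (toℕ i + 2) * μ i))) (suc p) ℓ →
    ContainsSunflower H (suc p) ℓ
  lift₂ {k′} k′≤k∸2 μ μ≥1 μ-free =
    highDegreeSunflower⇒sunflower uniform 1≤k (≤-trans k′≤k∸2 (m∸n≤m k 2))
      (prodFin-positive _ (λ i → (toℕ i + 2) * μ i)
        (λ i → *-mono-≤ (≤-trans (s≤s z≤n) (m≤n+m 2 (toℕ i))) (μ≥1 i)))
      (λ ∣B∣≡ → degree-bound uniform (k ∸ k′ ∸ 1) N<k μ μ-free (trans ∣B∣≡ (sym k∸N≡1+k′))) ≤-refl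
    where
    N<k : k ∸ k′ ∸ 1 < k
    N<k = proj₁ (k∸k′∸1<k×k∸[k∸k′∸1]≡1+k′ 1≤k k′≤k∸2)
    k∸N≡1+k′ : k ∸ (k ∸ k′ ∸ 1) ≡ suc k′
    k∸N≡1+k′ = proj₂ (k∸k′∸1<k×k∸[k∸k′∸1]≡1+k′ 1≤k k′≤k∸2)
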